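{- Let $n$ be a perfect square and let $$f = \bigvee_{i=0}^{\sqrt n -1}{\rm Parity}_{\sqrt n}(x_{\sqrt n \cdot i + 1}, x_{\sqrt n \cdot i + 2}, \ldots, x_{\sqrt n \cdot i + \sqrt n}).$$ Then $size^{\rm dc}(f) = 3n - o(n)$.
   Context: ${\rm Parity}_m(x_1,\dots,x_m)=1$ iff $\sum x_i\equiv 1 \pmod 2$. $U_2$ is the set of Boolean functions of the form $((x\oplus a)\wedge(y\oplus b))\oplus c$, $a,b,c\in\{0,1\}$ (all two-variable functions except XOR and its complement). A $U_2$-circuit has fan-in-2 gates labeled by functions in $U_2$; its size is the number of gates. A deterministic circuit has only the inputs $x_1,\dots,x_n$ (no guess inputs). $size^{\rm dc}(f)$ is the size of the smallest deterministic $U_2$-circuit computing $f$. -}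

module Defs where

open import Data.Nat using (ℕ; zero; suc)
open import Data.Bool using (Bool; true; false; _∧_; _∨_; _xor_)
open import Data.Fin using (Fin; combine)
open import Data.Vec using (Vec; []; _∷ʳ_; lookup; foldr; tabulate)
open import Data.Product using (Σ; _×_; _,_)
open import Relation.Binary.PropositionalEquality using (_≡_)

record Gate (w : ℕ) : Set where
  constructor gate
  field
    a b c : Bool
    l r   : Fin w

U2 : Bool → Bool → Bool → Bool → Bool → Bool
U2 a b c x y = ((x xor a) ∧ (y xor b)) xor c

-- A deterministic U₂-circuit body on n inputs with w wires in total:
-- wires 0..n-1 are the inputs x₁..xₙ, each gate adds one new wire.
data Gates (n : ℕ) : ℕ → Set where
  []  : Gates n n
  _▷_ : ∀ {w} → Gates n w → Gate w → Gates n (suc w)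

gcount : ∀ {n w} → Gates n w → ℕ
gcount []       = 0
gcount (gs ▷ g) = suc (gcount gs)

evalW : ∀ {n w} → Gates n w → Vec Bool n → Vec Bool w
evalW []       x = x
evalW (gs ▷ gate a b c l r) x =
  let v = evalW gs x in v ∷ʳ U2 a b c (lookup v l) (lookup v r)

record Circuit (n : ℕ) : Set where
  constructor circuit
  field
    {wires} : ℕ
    gates   : Gates n wires
    out     : Fin wires

size : ∀ {n} → Circuit n → ℕ
size C = gcount (Circuit.gates C)

Computes : ∀ {n} → Circuit n → (Vec Bool n → Bool) → Set
Computes {n} C f = ∀ (x : Vec Bool n) → lookup (evalW (Circuit.gates C) x) (Circuit.out C) ≡ f x

parity : ∀ {m} → Vec Bool m → Bool
parity = foldr _ _xor_ false

orV : ∀ {m} → Vec Bool m → Bool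
orV = foldr _ _∨_ false

-- f on n = m*m inputs: OR over i < m of Parity_m(x_{m i + 1}, …, x_{m i + m}).
-- (toℕ (combine i j) = m * toℕ i + toℕ j, 0-indexed.)
blockOrParity : (m : ℕ) → Vec Bool (m Data.Nat.* m) → Bool
blockOrParity m x = orV (tabulate λ (i : Fin m) → parity (tabulate λ (j : Fin m) → lookup x (combine i j)))

-- Upper bound: starting from a wire that is constantly false, the parity of a block of m
-- variables costs 3 gates per variable, and each block costs one more OR gate, in total
-- m (3m + 1) + 1 = 3n + O(√n) gates.
--
-- Lower bound, by gate elimination: gates that read a constant, read the same wire twice
-- or are never read can be removed.  In a circuit without such gates, the first gate
-- reads two distinct variables u and v.  If v is read nowhere else, fixing u so that the
-- first gate becomes constant makes the circuit independent of v.  Otherwise fixing v so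
-- that the first gate becomes constant removes it, its reader and the other reader of v.
-- For the OR of parities this can be repeated n − √n times: fixing a variable that shares
-- its block with another one leaves a function of the same shape, and fixing the last
-- variable of a block so that the block's parity term becomes false removes the block.
-- So at least 3(n − √n) gates are needed.

module Submission where

open import Defs
open import Algebra.Bundles using (CommutativeRing)
import Algebra.Properties.CommutativeMonoid.Sum as CommutativeMonoidSum
import Algebra.Properties.Semiring.Sum as SemiringSum
open import Data.Nat using (ℕ; zero; suc; _+_; _*_; _∸_; _<_; _≤_; _≤?_; z≤n; s≤s)
open import Data.Nat.Properties
  using (<-≤-trans; <-irrefl; n<1+n; ≤-trans; n≤1+n; <⇒≤; m<m+n; +-comm; +-monoʳ-≤; *-monoˡ-≤; *-monoʳ-≤; *-suc; *-identityˡ;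
         *-distribˡ-∸; *-distribʳ-∸; ∸-monoʳ-≤; 0∸n≡0; +-∸-assoc; m≤n⇒m∸n≡0; ≰⇒>; module ≤-Reasoning)
open import Data.Nat.Tactic.RingSolver using (solve-∀)
open import Data.Bool using (Bool; true; false; not; _∧_; _∨_; _xor_; if_then_else_)
import Data.Bool as Bool
open import Data.Bool.Properties
  using (xor-assoc; xor-identityʳ; xor-same; xor-inverseʳ; xor-is-ok; not-distribˡ-xor; ∧-comm; ∧-idem; ∧-zeroʳ; ∧-inverseʳ;
         if-float; xor-∧-commutativeRing; ∨-commutativeMonoid)
open import Data.Fin as Fin using (Fin; zero; suc; toℕ; fromℕ; inject₁; punchIn; punchOut; combine; quotient; _↑ˡ_; _↑ʳ_)
import Data.Fin.Properties as FinP
open import Data.Fin.Relation.Unary.Top using (view; ‵fromℕ; ‵inj₁; view-fromℕ; view-inject₁)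
open import Data.Vec using (Vec; []; _∷_; _∷ʳ_; lookup; insertAt; updateAt; tabulate)
open import Data.Vec.Properties using (insertAt-lookup; insertAt-punchIn; lookup∘updateAt; lookup∘updateAt′; lookup∘tabulate)
open import Data.Product using (Σ; ∃; ∃-syntax; _×_; _,_; proj₁; proj₂)
open import Data.Sum using (_⊎_; inj₁; inj₂)
open import Data.Unit using (⊤; tt)
open import Data.Empty using (⊥; ⊥-elim)
open import Function using (_∘_)
open import Relation.Nullary using (¬_; Dec; yes; no; ¬?; does)
open import Relation.Nullary.Decidable using (map′; _⊎-dec_; decidable-stable; dec-true; dec-false)
open import Relation.Binary.PropositionalEquality

private
  variable
    n k m w w′ w″ d d′ B : ℕ
    A : Set


data Side : Set where
  left right : Side

sides : A → A → Side → A
sides x y left  = x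
sides x y right = y

-- Every gate argument and the output is a literal (a possibly negated
-- constant, input or earlier gate), so that a gate can be deleted and replaced by any
-- literal that computes it.
data Source (n k : ℕ) : Set where
  const : Bool → Source n k
  input : Fin n → Source n k
  node  : Fin k → Source n k

infix 4 _≺_

-- q may live in a larger circuit: a literal replacing gate p is compared with p itself.

_≺_ : Source n k → Fin m → Set
node p  ≺ q = toℕ p < toℕ q
const _ ≺ q = ⊤
input _ ≺ q = ⊤

record Literal (n k : ℕ) : Set where
  constructor _⊕_
  field
    source : Source n k
    neg    : Bool
open Literal

_⊕ˡ_ : Literal n k → Bool → Literal n k
L ⊕ˡ c = source L ⊕ (neg L xor c)

record Node (n k : ℕ) : Set where
  constructor mkNode
  field
    arg    : Side → Literal n k
    negOut : Bool
open Node

record FlatCircuit (n k : ℕ) : Set where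
  field
    nodes   : Fin k → Node n k
    acyclic : ∀ q s → source (arg (nodes q) s) ≺ q
    output  : Literal n k
open FlatCircuit

readSource : Vec Bool n → (Fin k → Bool) → Source n k → Bool
readSource x V (const b) = b
readSource x V (input i) = lookup x i
readSource x V (node p)  = V p

readLiteral : Vec Bool n → (Fin k → Bool) → Literal n k → Bool
readLiteral x V L = readSource x V (source L) xor neg L

evalNode : Vec Bool n → (Fin k → Bool) → Node n k → Bool
evalNode x V g = (readLiteral x V (arg g left) ∧ readLiteral x V (arg g right)) xor negOut g

readLiteral-⊕ˡ : ∀ (x : Vec Bool n) (V : Fin k → Bool) L c →
                 readLiteral x V (L ⊕ˡ c) ≡ readLiteral x V L xor c
readLiteral-⊕ˡ x V L c = sym (xor-assoc (readSource x V (source L)) (neg L) c)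

evalNode-by-args : ∀ {n n′ k k′} {x : Vec Bool n} {x′ : Vec Bool n′} {V : Fin k → Bool} {V′ : Fin k′ → Bool}
                   (g : Node n k) (g′ : Node n′ k′) → negOut g ≡ negOut g′ →
                   (∀ s → readLiteral x V (arg g s) ≡ readLiteral x′ V′ (arg g′ s)) → evalNode x V g ≡ evalNode x′ V′ g′
evalNode-by-args g g′ same-out same-args = cong₂ _xor_ (cong₂ _∧_ (same-args left) (same-args right)) same-out

readSource-cong : ∀ (x : Vec Bool n) {V W : Fin k → Bool} s → V ≗ W → readSource x V s ≡ readSource x W s
readSource-cong x (const _) V≗W = refl
readSource-cong x (input _) V≗W = refl
readSource-cong x (node p)  V≗W = V≗W p

readLiteral-cong : ∀ (x : Vec Bool n) {V W : Fin k → Bool} L → V ≗ W → readLiteral x V L ≡ readLiteral x W L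
readLiteral-cong x L V≗W = cong (_xor neg L) (readSource-cong x (source L) V≗W)

AgreeBelow : Fin k → (V W : Fin k → Bool) → Set
AgreeBelow q V W = ∀ p → toℕ p < toℕ q → V p ≡ W p

readSource-agree : ∀ (x : Vec Bool n) {V W : Fin k → Bool} q s → s ≺ q → AgreeBelow q V W →
                   readSource x V s ≡ readSource x W s
readSource-agree x q (const _) _ agree = refl
readSource-agree x q (input _) _ agree = refl
readSource-agree x q (node p) p<q agree = agree p p<q

module _ (C : FlatCircuit n k) (x : Vec Bool n) where

  Consistent : (Fin k → Bool) → Set
  Consistent V = ∀ q → V q ≡ evalNode x V (nodes C q)

  evalNode-agree : ∀ {V W} q → AgreeBelow q V W → evalNode x V (nodes C q) ≡ evalNode x W (nodes C q)
  evalNode-agree q agree = evalNode-by-args (nodes C q) (nodes C q) refl λ s →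
    cong (_xor neg (arg (nodes C q) s)) (readSource-agree x q _ (acyclic C q s) agree)

  -- Evaluation with fuel: gate q is evaluated correctly once the fuel exceeds toℕ q.
  valueWithin : ℕ → Fin k → Bool
  valueWithin zero    q = false
  valueWithin (suc f) q = evalNode x (valueWithin f) (nodes C q)

  valueWithin-stable : ∀ f f′ q → toℕ q < f → toℕ q < f′ → valueWithin f q ≡ valueWithin f′ q
  valueWithin-stable (suc f) (suc f′) q (s≤s q<f) (s≤s q<f′) = evalNode-agree q λ p p<q →
    valueWithin-stable f f′ p (<-≤-trans p<q q<f) (<-≤-trans p<q q<f′)

  value : Fin k → Bool
  value q = valueWithin (suc (toℕ q)) q

  value-consistent : Consistent value
  value-consistent q = evalNode-agree q λ p p<q →
    valueWithin-stable (toℕ q) (suc (toℕ p)) p p<q (n<1+n _)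

  consistent-unique : ∀ {V W} → Consistent V → Consistent W → V ≗ W
  consistent-unique {V} {W} cV cW q = go (suc (toℕ q)) q (n<1+n _)
    where
    go : ∀ f q → toℕ q < f → V q ≡ W q
    go (suc f) q (s≤s q<f) = begin
      V q                        ≡⟨ cV q ⟩
      evalNode x V (nodes C q)   ≡⟨ evalNode-agree q (λ p p<q → go f p (<-≤-trans p<q q<f)) ⟩
      evalNode x W (nodes C q)   ≡⟨ sym (cW q) ⟩
      W q                        ∎
      where open ≡-Reasoning

  consistent⇒value : ∀ {V} → Consistent V → value ≗ V
  consistent⇒value cV = consistent-unique value-consistent cV

  outputValue : Bool
  outputValue = readLiteral x value (output C)

FlatComputes : FlatCircuit n k → (Vec Bool n → Bool) → Set
FlatComputes C g = ∀ x → outputValue C x ≡ g x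

_[_≔_] : (Vec Bool (suc n) → Bool) → Fin (suc n) → Bool → Vec Bool n → Bool
(g [ u ≔ a ]) x = g (insertAt x u a)

fixSource : Fin (suc n) → Bool → Source (suc n) k → Source n k
fixSource u a (const b) = const b
fixSource u a (node p)  = node p
fixSource u a (input i) with u Fin.≟ i
... | yes _   = const a
... | no u≢i = input (punchOut u≢i)

fixLiteral : Fin (suc n) → Bool → Literal (suc n) k → Literal n k
fixLiteral u a L = fixSource u a (source L) ⊕ neg L

fixSource-≺ : ∀ (u : Fin (suc n)) a (s : Source (suc n) k) (q : Fin m) → s ≺ q → fixSource u a s ≺ q
fixSource-≺ u a (const _) q _ = tt
fixSource-≺ u a (node _)  q p<q = p<q
fixSource-≺ u a (input i) q _ with u Fin.≟ i
... | yes _ = tt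
... | no _  = tt

fix : FlatCircuit (suc n) k → Fin (suc n) → Bool → FlatCircuit n k
fix C u a = record
  { nodes   = λ q → mkNode (λ s → fixLiteral u a (arg (nodes C q) s)) (negOut (nodes C q))
  ; acyclic = λ q s → fixSource-≺ u a _ q (acyclic C q s)
  ; output  = fixLiteral u a (output C)
  }

fixSource-input : ∀ (u : Fin (suc n)) a → fixSource {k = k} u a (input u) ≡ const a
fixSource-input u a with u Fin.≟ u
... | yes _   = refl
... | no u≢u = ⊥-elim (u≢u refl)

fixSource≡input : ∀ (u : Fin (suc n)) a (s : Source (suc n) k) j →
                  fixSource u a s ≡ input j → s ≡ input (punchIn u j)
fixSource≡input u a (input i) j eq with u Fin.≟ i
fixSource≡input u a (input i) j refl | no u≢i = cong input (sym (FinP.punchIn-punchOut u≢i))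

readSource-fix : ∀ (u : Fin (suc n)) a x (V : Fin k → Bool) s →
                 readSource x V (fixSource u a s) ≡ readSource (insertAt x u a) V s
readSource-fix u a x V (const b) = refl
readSource-fix u a x V (node p)  = refl
readSource-fix u a x V (input i) with u Fin.≟ i
... | yes refl = sym (insertAt-lookup x u a)
... | no u≢i  = begin
  lookup x (punchOut u≢i)                             ≡⟨ sym (insertAt-punchIn x u a (punchOut u≢i)) ⟩
  lookup (insertAt x u a) (punchIn u (punchOut u≢i))  ≡⟨ cong (lookup (insertAt x u a)) (FinP.punchIn-punchOut u≢i) ⟩
  lookup (insertAt x u a) i                           ∎
  where open ≡-Reasoning

readLiteral-fix : ∀ (u : Fin (suc n)) a x (V : Fin k → Bool) L →
                  readLiteral x V (fixLiteral u a L) ≡ readLiteral (insertAt x u a) V L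
readLiteral-fix u a x V L = cong (_xor neg L) (readSource-fix u a x V (source L))

value-fix : ∀ (C : FlatCircuit (suc n) k) u a x → value (fix C u a) x ≗ value C (insertAt x u a)
value-fix C u a x = consistent⇒value (fix C u a) x λ q →
  trans (value-consistent C _ q)
        (sym (evalNode-by-args (nodes (fix C u a) q) (nodes C q) refl λ s → readLiteral-fix u a x _ (arg (nodes C q) s)))

fix-computes : ∀ (C : FlatCircuit (suc n) k) g u a → FlatComputes C g → FlatComputes (fix C u a) (g [ u ≔ a ])
fix-computes C g u a C⊨g x = begin
  readLiteral x (value (fix C u a) x) (fixLiteral u a (output C))
    ≡⟨ readLiteral-cong x (fixLiteral u a (output C)) (value-fix C u a x) ⟩
  readLiteral x (value C (insertAt x u a)) (fixLiteral u a (output C))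
    ≡⟨ readLiteral-fix u a x _ (output C) ⟩
  outputValue C (insertAt x u a)
    ≡⟨ C⊨g (insertAt x u a) ⟩
  g (insertAt x u a) ∎
  where open ≡-Reasoning

punchIn-above⇒≤ : ∀ (p : Fin (suc k)) q → toℕ p < toℕ (punchIn p q) → toℕ p ≤ toℕ q
punchIn-above⇒≤ zero    q       _         = z≤n
punchIn-above⇒≤ (suc p) (suc q) (s≤s p<q) = s≤s (punchIn-above⇒≤ p q p<q)

punchOut-<-punchIn : ∀ {p r : Fin (suc k)} (p≢r : p ≢ r) q →
                     toℕ r < toℕ (punchIn p q) → toℕ (punchOut p≢r) < toℕ q
punchOut-<-punchIn {p = zero}  {zero}  p≢r q       _           = ⊥-elim (p≢r refl)
punchOut-<-punchIn {p = zero}  {suc r} p≢r q       (s≤s r<q)   = r<q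
punchOut-<-punchIn {k = suc k} {suc p} {zero}  p≢r (suc q) _         = s≤s z≤n
punchOut-<-punchIn {k = suc k} {suc p} {suc r} p≢r (suc q) (s≤s r<q) =
  s≤s (punchOut-<-punchIn (λ p≡r → p≢r (cong suc p≡r)) q r<q)

punchOut-<-self : ∀ {p r : Fin (suc k)} (p≢r : p ≢ r) → toℕ r < toℕ p → toℕ (punchOut p≢r) < toℕ p
punchOut-<-self {k = suc k} {suc p} {zero}  p≢r _         = s≤s z≤n
punchOut-<-self {k = suc k} {suc p} {suc r} p≢r (s≤s r<p) =
  s≤s (punchOut-<-self (λ p≡r → p≢r (cong suc p≡r)) r<p)

≺-weaken : ∀ (s : Source n k) {p : Fin m} {q : Fin k} → s ≺ p → toℕ p ≤ toℕ q → s ≺ q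
≺-weaken (const _) _ _ = tt
≺-weaken (input _) _ _ = tt
≺-weaken (node r) r<p p≤q = <-≤-trans r<p p≤q

redirect : Fin (suc k) → Literal n k → Source n (suc k) → Literal n k
redirect p L (const b) = const b ⊕ false
redirect p L (input i) = input i ⊕ false
redirect p L (node q) with p Fin.≟ q
... | yes _   = L
... | no p≢q = node (punchOut p≢q) ⊕ false

redirectLiteral : Fin (suc k) → Literal n k → Literal n (suc k) → Literal n k
redirectLiteral p L M = redirect p L (source M) ⊕ˡ neg M

redirect-≺ : ∀ (p : Fin (suc k)) (L : Literal n k) q s → source L ≺ p → s ≺ punchIn p q →
             source (redirect p L s) ≺ q
redirect-≺ p L q (const _) _ _ = tt
redirect-≺ p L q (input _) _ _ = tt
redirect-≺ p L q (node r) L≺p r<q with p Fin.≟ r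
... | yes refl = ≺-weaken (source L) L≺p (punchIn-above⇒≤ p q r<q)
... | no p≢r  = punchOut-<-punchIn p≢r q r<q

remove : (C : FlatCircuit n (suc k)) (p : Fin (suc k)) (L : Literal n k) → source L ≺ p → FlatCircuit n k
remove C p L L≺p = record
  { nodes   = λ q → mkNode (λ s → redirectLiteral p L (arg (nodes C (punchIn p q)) s)) (negOut (nodes C (punchIn p q)))
  ; acyclic = λ q s → redirect-≺ p L q _ L≺p (acyclic C (punchIn p q) s)
  ; output  = redirectLiteral p L (output C)
  }

readSource-redirect : ∀ (p : Fin (suc k)) (L : Literal n k) x (V : Fin (suc k) → Bool) s →
                      (s ≡ node p → V p ≡ readLiteral x (V ∘ punchIn p) L) →
                      readLiteral x (V ∘ punchIn p) (redirect p L s) ≡ readSource x V s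
readSource-redirect p L x V (const b) _ = xor-identityʳ b
readSource-redirect p L x V (input i) _ = xor-identityʳ _
readSource-redirect p L x V (node q) reads-p with p Fin.≟ q
... | yes refl = sym (reads-p refl)
... | no p≢q  = trans (xor-identityʳ _) (cong V (FinP.punchIn-punchOut p≢q))

readLiteral-redirect : ∀ (p : Fin (suc k)) (L : Literal n k) x (V : Fin (suc k) → Bool) M →
                       (source M ≡ node p → V p ≡ readLiteral x (V ∘ punchIn p) L) →
                       readLiteral x (V ∘ punchIn p) (redirectLiteral p L M) ≡ readLiteral x V M
readLiteral-redirect p L x V M reads-p =
  trans (readLiteral-⊕ˡ x _ (redirect p L (source M)) (neg M))
        (cong (_xor neg M) (readSource-redirect p L x V (source M) reads-p))

ReadsGate : FlatCircuit n k → Fin k → Set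
ReadsGate C p = (∃[ q ] ∃[ s ] source (arg (nodes C q) s) ≡ node p) ⊎ source (output C) ≡ node p

Simulates : FlatCircuit n (suc k) → Fin (suc k) → Literal n k → Set
Simulates C p L = ∀ x → value C x p ≡ readLiteral x (value C x ∘ punchIn p) L

module _ (C : FlatCircuit n (suc k)) (p : Fin (suc k)) (L : Literal n k) (L≺p : source L ≺ p)
         (simulates : ReadsGate C p → Simulates C p L) where

  value-remove : ∀ x → value (remove C p L L≺p) x ≗ value C x ∘ punchIn p
  value-remove x = consistent⇒value (remove C p L L≺p) x λ q →
    trans (value-consistent C x (punchIn p q))
          (sym (evalNode-by-args (nodes (remove C p L L≺p) q) (nodes C (punchIn p q)) refl λ s →
                  readLiteral-redirect p L x (value C x) (arg (nodes C (punchIn p q)) s) λ e →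
                    simulates (inj₁ (punchIn p q , s , e)) x))

  remove-computes : ∀ g → FlatComputes C g → FlatComputes (remove C p L L≺p) g
  remove-computes g C⊨g x = begin
    readLiteral x (value (remove C p L L≺p) x) (redirectLiteral p L (output C))
      ≡⟨ readLiteral-cong x (redirectLiteral p L (output C)) (value-remove x) ⟩
    readLiteral x (value C x ∘ punchIn p) (redirectLiteral p L (output C))
      ≡⟨ readLiteral-redirect p L x (value C x) (output C) (λ e → simulates (inj₂ e) x) ⟩
    outputValue C x
      ≡⟨ C⊨g x ⟩
    g x ∎
    where open ≡-Reasoning

other : Side → Side
other left  = right
other right = left

constant : Bool → Literal n k
constant b = const b ⊕ false

IsConst : Source n k → Set
IsConst s = ∃[ v ] s ≡ const v

Degenerate : Node n k → Set
Degenerate g = (∃[ s ] IsConst (source (arg g s))) ⊎ source (arg g left) ≡ source (arg g right)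

shortcut : (g : Node n k) → Degenerate g → Literal n k
shortcut g (inj₁ (s , v , _)) =
  if v xor neg (arg g s) then arg g (other s) ⊕ˡ negOut g else constant (negOut g)
shortcut g (inj₂ _) =
  if neg (arg g left) xor neg (arg g right) then constant (negOut g) else arg g left ⊕ˡ negOut g

shortcut-≺ : ∀ (g : Node n k) d (q : Fin m) → (∀ s → source (arg g s) ≺ q) → source (shortcut g d) ≺ q
shortcut-≺ g (inj₁ (s , v , _)) q args≺q with v xor neg (arg g s)
... | true  = args≺q (other s)
... | false = tt
shortcut-≺ g (inj₂ _) q args≺q with neg (arg g left) xor neg (arg g right)
... | true  = tt
... | false = args≺q left

∧-const-left : ∀ w y b c → (w ∧ (y xor b)) xor c ≡ (if w then y xor (b xor c) else c xor false)
∧-const-left true  y b c = xor-assoc y b c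
∧-const-left false y b c = sym (xor-identityʳ c)

∧-const-right : ∀ w y a c → ((y xor a) ∧ w) xor c ≡ (if w then y xor (a xor c) else c xor false)
∧-const-right w y a c = trans (cong (_xor c) (∧-comm (y xor a) w)) (∧-const-left w y a c)

∧-same : ∀ y a b c → ((y xor a) ∧ (y xor b)) xor c ≡ (if a xor b then c xor false else y xor (a xor c))
∧-same y     false false c = trans (cong (_xor c) (∧-idem (y xor false))) (xor-assoc y false c)
∧-same y     true  true  c = trans (cong (_xor c) (∧-idem (y xor true))) (xor-assoc y true c)
∧-same false false true  c = sym (xor-identityʳ c)
∧-same true  false true  c = sym (xor-identityʳ c)
∧-same false true  false c = sym (xor-identityʳ c)
∧-same true  true  false c = sym (xor-identityʳ c)

module _ (x : Vec Bool n) (V : Fin k → Bool) (g : Node n k) where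
  private
    a = neg (arg g left)
    b = neg (arg g right)
    y = readSource x V (source (arg g left))
    z = readSource x V (source (arg g right))

  evalNode-shortcut : ∀ d → evalNode x V g ≡ readLiteral x V (shortcut g d)
  evalNode-shortcut (inj₁ (left , v , eq)) =
    trans (cong (λ s → ((readSource x V s xor a) ∧ (z xor b)) xor negOut g) eq)
          (trans (∧-const-left (v xor a) z b (negOut g)) (sym (if-float (readLiteral x V) (v xor a))))
  evalNode-shortcut (inj₁ (right , v , eq)) =
    trans (cong (λ s → ((y xor a) ∧ (readSource x V s xor b)) xor negOut g) eq)
          (trans (∧-const-right (v xor b) y a (negOut g)) (sym (if-float (readLiteral x V) (v xor b))))
  evalNode-shortcut (inj₂ same) =
    trans (cong (λ s → ((y xor a) ∧ (readSource x V s xor b)) xor negOut g) (sym same))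
          (trans (∧-same y a b (negOut g)) (sym (if-float (readLiteral x V) (a xor b))))

-- The arguments of gate p never read p, so the literal they are redirected to is irrelevant.
lowerLiteral : Fin (suc k) → Literal n (suc k) → Literal n k
lowerLiteral p = redirectLiteral p (constant false)

≺-irrefl : ∀ (p : Fin k) (s : Source n k) → s ≺ p → s ≢ node p
≺-irrefl p (node .p) p<p refl = <-irrefl refl p<p

readLiteral-lower : ∀ (p : Fin (suc k)) x (V : Fin (suc k) → Bool) (M : Literal n (suc k)) → source M ≺ p →
                    readLiteral x (V ∘ punchIn p) (lowerLiteral p M) ≡ readLiteral x V M
readLiteral-lower p x V M M≺p = readLiteral-redirect p _ x V M λ e → ⊥-elim (≺-irrefl p (source M) M≺p e)

redirect-≺-self : ∀ (p : Fin (suc k)) (L : Literal n k) s → s ≺ p → source (redirect p L s) ≺ p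
redirect-≺-self p L (const _) _ = tt
redirect-≺-self p L (input _) _ = tt
redirect-≺-self p L (node r) r<p with p Fin.≟ r
... | yes refl = ⊥-elim (<-irrefl refl r<p)
... | no p≢r  = punchOut-<-self p≢r r<p

Eliminable : FlatCircuit n k → Fin k → Set
Eliminable C p = Degenerate (nodes C p) ⊎ ¬ ReadsGate C p

eliminate : (C : FlatCircuit n (suc k)) (p : Fin (suc k)) → Eliminable C p → FlatCircuit n k
eliminate C p (inj₁ d) = remove C p (lowerLiteral p (shortcut (nodes C p) d))
  (redirect-≺-self p _ _ (shortcut-≺ (nodes C p) d p (acyclic C p)))
eliminate C p (inj₂ _) = remove C p (constant false) tt

eliminate-computes : ∀ (C : FlatCircuit n (suc k)) p e g → FlatComputes C g → FlatComputes (eliminate C p e) g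
eliminate-computes C p (inj₁ d) = remove-computes C p _ _ λ _ x →
  trans (value-consistent C x p)
        (trans (evalNode-shortcut x (value C x) (nodes C p) d)
               (sym (readLiteral-lower p x (value C x) _ (shortcut-≺ (nodes C p) d p (acyclic C p)))))
eliminate-computes C p (inj₂ unread) = remove-computes C p _ _ λ reads → ⊥-elim (unread reads)

_≟ˢ_ : (s t : Source n k) → Dec (s ≡ t)
const a ≟ˢ const b = map′ (cong const) (λ { refl → refl }) (a Bool.≟ b)
input i ≟ˢ input j = map′ (cong input) (λ { refl → refl }) (i Fin.≟ j)
node p  ≟ˢ node q  = map′ (cong node) (λ { refl → refl }) (p Fin.≟ q)
const _ ≟ˢ input _ = no λ ()
const _ ≟ˢ node _  = no λ ()
input _ ≟ˢ const _ = no λ ()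
input _ ≟ˢ node _  = no λ ()
node _  ≟ˢ const _ = no λ ()
node _  ≟ˢ input _ = no λ ()

isConst? : (s : Source n k) → Dec (IsConst s)
isConst? (const v) = yes (v , refl)
isConst? (input _) = no λ ()
isConst? (node _)  = no λ ()

anySide? : {P : Side → Set} → (∀ s → Dec (P s)) → Dec (∃ P)
anySide? P? with P? left | P? right
... | yes pl | _      = yes (left , pl)
... | no _   | yes pr = yes (right , pr)
... | no ¬pl | no ¬pr = no λ { (left , pl) → ¬pl pl ; (right , pr) → ¬pr pr }

readsGate? : (C : FlatCircuit n k) (p : Fin k) → Dec (ReadsGate C p)
readsGate? C p = FinP.any? (λ q → anySide? λ s → source (arg (nodes C q) s) ≟ˢ node p)
                 ⊎-dec (source (output C) ≟ˢ node p)

eliminable? : (C : FlatCircuit n k) (p : Fin k) → Dec (Eliminable C p)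
eliminable? C p = (anySide? (λ s → isConst? (source (arg (nodes C p) s)))
                   ⊎-dec (source (arg (nodes C p) left) ≟ˢ source (arg (nodes C p) right)))
                  ⊎-dec ¬? (readsGate? C p)

redirect-const : ∀ (p : Fin (suc k)) (L : Literal n k) {s} → IsConst s → IsConst (source (redirect p L s))
redirect-const p L (v , refl) = v , refl

redirect-removed : ∀ (p : Fin (suc k)) (L : Literal n k) {s} → s ≡ node p → IsConst (source L) →
                   IsConst (source (redirect p L s))
redirect-removed p L refl L-const with p Fin.≟ p
... | yes _   = L-const
... | no p≢p = ⊥-elim (p≢p refl)

redirect-other : ∀ {p r : Fin (suc k)} (L : Literal n k) {s} → s ≡ node r → (p≢r : p ≢ r) →
                 source (redirect p L s) ≡ node (punchOut p≢r)
redirect-other {p = p} {r} L refl p≢r with p Fin.≟ r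
... | yes p≡r = ⊥-elim (p≢r p≡r)
... | no p≢r′ = cong node (FinP.punchOut-cong p refl)

shortcut-killed : ∀ (g : Node n k) s v (e : source (arg g s) ≡ const v) → v xor neg (arg g s) ≡ false →
                  IsConst (source (shortcut g (inj₁ (s , v , e))))
shortcut-killed g s v e kill rewrite kill = negOut g , refl

shortcut-constants : ∀ (g : Node n k) d → IsConst (source (arg g left)) → IsConst (source (arg g right)) →
                     IsConst (source (shortcut g (inj₁ d)))
shortcut-constants g (s , v , _) cl cr with v xor neg (arg g s)
shortcut-constants g (left  , v , _) cl cr | true  = cr
shortcut-constants g (right , v , _) cl cr | true  = cl
shortcut-constants g (s     , v , _) cl cr | false = negOut g , refl

DependsOn : (Vec Bool n → Bool) → Fin n → Set
DependsOn g j = ∃[ x ] g x ≢ g (updateAt x j not)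

NonConstant : (Vec Bool n → Bool) → Set
NonConstant g = ∃[ x ] ∃[ y ] g x ≢ g y

-- Hard n g t: gate elimination can be run t times on g.
Hard : (n : ℕ) → (Vec Bool n → Bool) → ℕ → Set
Essential : (n : ℕ) → (Vec Bool n → Bool) → ℕ → Set
Hard zero    g t = t ≡ 0
Hard (suc n) g t = ∀ i → (∃[ a ] Hard n (g [ i ≔ a ]) t)
                       ⊎ (∃[ t′ ] t ≡ suc t′ × ∀ a → Essential n (g [ i ≔ a ]) t′)
Essential n g t = Hard n g t × NonConstant g × (∀ j → DependsOn g j)

dependsOn-≗ : ∀ {g g′ : Vec Bool n → Bool} {j} → g ≗ g′ → DependsOn g j → DependsOn g′ j
dependsOn-≗ g≗g′ (x , differ) = x , λ e → differ (trans (g≗g′ _) (trans e (sym (g≗g′ _))))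

nonConstant-≗ : ∀ {g g′ : Vec Bool n → Bool} → g ≗ g′ → NonConstant g → NonConstant g′
nonConstant-≗ g≗g′ (x , y , differ) = x , y , λ e → differ (trans (g≗g′ x) (trans e (sym (g≗g′ y))))

hard-≗ : ∀ n {g g′ : Vec Bool n → Bool} {t} → g ≗ g′ → Hard n g t → Hard n g′ t
hard-≗ zero    g≗g′ hard = hard
hard-≗ (suc n) g≗g′ hard i with hard i
... | inj₁ (a , hard′) = inj₁ (a , hard-≗ n (g≗g′ ∘ _) hard′)
... | inj₂ (t′ , t≡ , essential) = inj₂ (t′ , t≡ , λ a →
  let (hard′ , nonConst , depends) = essential a
  in hard-≗ n (g≗g′ ∘ _) hard′ , nonConstant-≗ (g≗g′ ∘ _) nonConst , λ j → dependsOn-≗ (g≗g′ ∘ _) (depends j))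

hard-zero : ∀ n (g : Vec Bool n → Bool) → Hard n g 0
hard-zero zero    g = refl
hard-zero (suc n) g i = inj₁ (false , hard-zero n _)

nonConstant-unfix : ∀ (g : Vec Bool (suc n) → Bool) i a → NonConstant (g [ i ≔ a ]) → NonConstant g
nonConstant-unfix g i a (x , y , gx≢gy) = insertAt x i a , insertAt y i a , gx≢gy

hard-nonConstant : ∀ n {g : Vec Bool n → Bool} {t} → Hard n g (suc t) → NonConstant g
hard-nonConstant zero    ()
hard-nonConstant (suc n) {g} hard with hard zero
... | inj₁ (a , hard′)         = nonConstant-unfix g zero a (hard-nonConstant n hard′)
... | inj₂ (_ , _ , essential) = nonConstant-unfix g zero false (proj₁ (proj₂ (essential false)))

fixing-nonConstant : ∀ (g : Vec Bool (suc n) → Bool) {t} → Hard (suc n) g (suc t) → ∀ i →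
                     ∃[ a ] NonConstant (g [ i ≔ a ])
fixing-nonConstant {n} g hard i with hard i
... | inj₁ (a , hard′)         = a , hard-nonConstant n hard′
... | inj₂ (_ , _ , essential) = false , proj₁ (proj₂ (essential false))

const-output⇒constant : ∀ (C : FlatCircuit n k) {g} → FlatComputes C g → IsConst (source (output C)) → ¬ NonConstant g
const-output⇒constant C {g} C⊨g (v , out≡v) (x , y , gx≢gy) = gx≢gy (begin
  g x                  ≡⟨ sym (C⊨g x) ⟩
  outputValue C x      ≡⟨ constant-value x ⟩
  v xor neg (output C) ≡⟨ sym (constant-value y) ⟩
  outputValue C y      ≡⟨ C⊨g y ⟩
  g y                  ∎)
  where
  open ≡-Reasoning
  constant-value : ∀ z → outputValue C z ≡ v xor neg (output C)
  constant-value z = cong (λ s → readSource z (value C z) s xor neg (output C)) out≡v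

gateless-not-hard : ∀ (C : FlatCircuit (suc n) 0) {g t} → FlatComputes C g → ¬ Hard (suc n) g (suc t)
gateless-not-hard {n} C {g} C⊨g hard = by-output (source (output C)) refl
  where
  by-output : ∀ s → source (output C) ≡ s → ⊥
  by-output (const v) out = const-output⇒constant C C⊨g (v , out) (hard-nonConstant (suc n) hard)
  by-output (input i) out with fixing-nonConstant g hard i
  ... | a , nonConst = const-output⇒constant (fix C i a) (fix-computes C g i a C⊨g)
                         (a , trans (cong (fixSource i a) out) (fixSource-input i a)) nonConst

Blocked : Node n k → Set
Blocked g = ∃[ s ] source (arg g s) ≡ const (neg (arg g s))

evalNode-blocked : ∀ (x : Vec Bool n) (V : Fin k → Bool) g → Blocked g → evalNode x V g ≡ negOut g
evalNode-blocked x V g (left , e) =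
  cong (λ w → (w ∧ readLiteral x V (arg g right)) xor negOut g)
       (trans (cong (λ s → readSource x V s xor neg (arg g left)) e) (xor-same (neg (arg g left))))
evalNode-blocked x V g (right , e) =
  trans (cong (λ w → (readLiteral x V (arg g left) ∧ w) xor negOut g)
              (trans (cong (λ s → readSource x V s xor neg (arg g right)) e) (xor-same (neg (arg g right)))))
        (cong (_xor negOut g) (∧-zeroʳ (readLiteral x V (arg g left))))

readSource-flip : ∀ (x : Vec Bool n) (V : Fin k → Bool) j s → s ≢ input j →
                  readSource x V s ≡ readSource (updateAt x j not) V s
readSource-flip x V j (const _) _ = refl
readSource-flip x V j (node _)  _ = refl
readSource-flip x V j (input i) i≢j = sym (lookup∘updateAt′ i j (λ e → i≢j (cong input e)) x)

IgnoredBy : Fin n → Node n k → Set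
IgnoredBy j g = (∀ s → source (arg g s) ≢ input j) ⊎ Blocked g

output-ignores : ∀ (C : FlatCircuit n k) j → (∀ q → IgnoredBy j (nodes C q)) → source (output C) ≢ input j →
                 ∀ x → outputValue C x ≡ outputValue C (updateAt x j not)
output-ignores C j ignored out≢j x = begin
  readLiteral x V (output C)                         ≡⟨ cong (_xor neg (output C)) (readSource-flip x V j _ out≢j) ⟩
  readLiteral x′ V (output C)                        ≡⟨ readLiteral-cong x′ (output C) (sym ∘ consistent⇒value C x′ consistent) ⟩
  readLiteral x′ (value C x′) (output C)             ∎
  where
  open ≡-Reasoning
  V  = value C x
  x′ = updateAt x j not
  evalNode-flip : ∀ g → IgnoredBy j g → evalNode x V g ≡ evalNode x′ V g
  evalNode-flip g (inj₁ unread) = evalNode-by-args g g refl λ s →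
    cong (_xor neg (arg g s)) (readSource-flip x V j _ (unread s))
  evalNode-flip g (inj₂ blocked) = trans (evalNode-blocked x V g blocked) (sym (evalNode-blocked x′ V g blocked))
  consistent : Consistent C x′ V
  consistent q = trans (value-consistent C x q) (evalNode-flip (nodes C q) (ignored q))

ReadAgain : FlatCircuit n (suc k) → Fin n → Set
ReadAgain C v = (∃[ q ] ∃[ s ] source (arg (nodes C (suc q)) s) ≡ input v) ⊎ source (output C) ≡ input v

readAgain? : (C : FlatCircuit n (suc k)) (v : Fin n) → Dec (ReadAgain C v)
readAgain? C v = FinP.any? (λ q → anySide? λ s → source (arg (nodes C (suc q)) s) ≟ˢ input v)
                 ⊎-dec (source (output C) ≟ˢ input v)

-- Fixing u to block gate 0 cuts off every use of v.
single-reader : ∀ (C : FlatCircuit (suc n) (suc k)) g {u v} s₀ → FlatComputes C g →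
                source (arg (nodes C zero) s₀) ≡ input u → (u≢v : u ≢ v) → ¬ ReadAgain C v →
                ¬ DependsOn (g [ u ≔ neg (arg (nodes C zero) s₀) ]) (punchOut u≢v)
single-reader {n} {k} C g {u} {v} s₀ C⊨g reads-u u≢v ¬again (x , differ) =
  differ (trans (sym (D⊨ x)) (trans (output-ignores D j ignored (¬again ∘ inj₂ ∘ unfix) x) (D⊨ _)))
  where
  a = neg (arg (nodes C zero) s₀)
  D = fix C u a
  D⊨ = fix-computes C g u a C⊨g
  j = punchOut u≢v
  unfix : ∀ {s : Source (suc n) (suc k)} → fixSource u a s ≡ input j → s ≡ input v
  unfix e = trans (fixSource≡input u a _ j e) (cong input (FinP.punchIn-punchOut u≢v))
  ignored : ∀ q → IgnoredBy j (nodes D q)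
  ignored zero    = inj₂ (s₀ , trans (cong (fixSource u a) reads-u) (fixSource-input u a))
  ignored (suc q) = inj₁ λ s e → ¬again (inj₁ (q , s , unfix e))

FewerBy : ℕ → ℕ → (Vec Bool n → Bool) → Set
FewerBy {n} d k h = ∃[ k′ ] k ≡ d + k′ × Σ (FlatCircuit n k′) (λ D → FlatComputes D h)

ConstArg : FlatCircuit n k → Fin k → Side → Set
ConstArg D q s = IsConst (source (arg (nodes D q) s))

eliminate-constArg : ∀ (D : FlatCircuit n k) {h} q s → ConstArg D q s → FlatComputes D h → FewerBy 1 k h
eliminate-constArg {k = suc k} D q s c D⊨h =
  k , refl , eliminate D q (inj₁ (inj₁ (s , c))) , eliminate-computes D q (inj₁ (inj₁ (s , c))) _ D⊨h

reindex : ∀ {P : Fin (suc k) → Set} {p q} (p≢q : p ≢ q) → P q → P (punchIn p (punchOut p≢q))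
reindex {P = P} p≢q = subst P (sym (FinP.punchIn-punchOut p≢q))

both-sides : ∀ {P : Side → Set} {s₁ s₂} → s₁ ≢ s₂ → P s₁ → P s₂ → P left × P right
both-sides {s₁ = left}  {left}  s₁≢s₂ _  _  = ⊥-elim (s₁≢s₂ refl)
both-sides {s₁ = left}  {right} _     p₁ p₂ = p₁ , p₂
both-sides {s₁ = right} {left}  _     p₁ p₂ = p₂ , p₁
both-sides {s₁ = right} {right} s₁≢s₂ _  _  = ⊥-elim (s₁≢s₂ refl)

-- Eliminating q₁ leaves a second gate with a constant argument: H itself if H ≠ q₁, and
-- otherwise a reader of q₁, whose arguments are then both constant.
eliminate-two : ∀ (D : FlatCircuit n k) {h} → FlatComputes D h → NonConstant h → ∀ q₁ s₁ H sH →
                ConstArg D q₁ s₁ → ConstArg D H sH → (H ≡ q₁ → s₁ ≢ sH) → ReadsGate D q₁ → FewerBy 2 k h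
eliminate-two {k = suc k} D {h} D⊨h nonConst q₁ s₁ H sH c₁ cH both read-q₁ = by-H (q₁ Fin.≟ H)
  where
  d₂ = inj₁ (s₁ , c₁)
  L₂ = lowerLiteral q₁ (shortcut (nodes D q₁) d₂)
  D₂ = eliminate D q₁ (inj₁ d₂)
  D₂⊨ = eliminate-computes D q₁ (inj₁ d₂) h D⊨h
  third : ∀ X s → ConstArg D₂ X s → FewerBy 2 (suc k) h
  third X s c with eliminate-constArg D₂ X s c D₂⊨
  ... | k′ , refl , D′ = k′ , refl , D′
  by-H : Dec (q₁ ≡ H) → FewerBy 2 (suc k) h
  by-H (no q₁≢H) =
    third (punchOut q₁≢H) sH (redirect-const q₁ L₂ (reindex {P = λ q → ConstArg D q sH} q₁≢H cH))
  by-H (yes refl) = by-reader read-q₁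
    where
    constant-args = both-sides {P = ConstArg D q₁} (both refl) c₁ cH
    L₂-const : IsConst (source L₂)
    L₂-const = redirect-const q₁ _
      (shortcut-constants (nodes D q₁) (s₁ , c₁) (proj₁ constant-args) (proj₂ constant-args))
    by-reader : ReadsGate D q₁ → FewerBy 2 (suc k) h
    by-reader (inj₂ out≡q₁) =
      ⊥-elim (const-output⇒constant D₂ D₂⊨ (redirect-removed q₁ L₂ out≡q₁ L₂-const) nonConst)
    by-reader (inj₁ (H₂ , s , e)) = third (punchOut q₁≢H₂) s
      (redirect-removed q₁ L₂ (reindex {P = λ q → source (arg (nodes D q) s) ≡ node q₁} q₁≢H₂ e) L₂-const)
      where
      q₁≢H₂ : q₁ ≢ H₂
      q₁≢H₂ refl = ≺-irrefl q₁ _ (acyclic D q₁ s) e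

input≢node : ∀ {i : Fin n} {p : Fin k} → input i ≢ node p
input≢node ()

clean⇒readsGate : ∀ (C : FlatCircuit n k) → (∀ q → ¬ Eliminable C q) → ∀ q → ReadsGate C q
clean⇒readsGate C clean q = decidable-stable (readsGate? C q) (clean q ∘ inj₂)

-- Fixing v so that gate 0 becomes constant and eliminating gate 0 leaves constant
-- arguments at the other reader of v and at a reader of gate 0.
eliminate-three : ∀ (C : FlatCircuit (suc n) (suc k)) g → FlatComputes C g → (∀ q → ¬ Eliminable C q) →
                  ∀ {v} s₀ → source (arg (nodes C zero) s₀) ≡ input v → ReadAgain C v →
                  NonConstant (g [ v ≔ neg (arg (nodes C zero) s₀) ]) →
                  FewerBy 3 (suc k) (g [ v ≔ neg (arg (nodes C zero) s₀) ])
eliminate-three {n} {k} C g C⊨g clean {v} s₀ reads-v again nonConst =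
  by-readers again (clean⇒readsGate C clean zero)
  where
  a = neg (arg (nodes C zero) s₀)
  D₀ = fix C v a
  fixed : ∀ {s} → s ≡ input v → IsConst (fixSource {k = suc k} v a s)
  fixed e = a , trans (cong (fixSource v a) e) (fixSource-input v a)
  d₀ : Degenerate (nodes D₀ zero)
  d₀ = inj₁ (s₀ , fixed reads-v)
  L₁ = lowerLiteral zero (shortcut (nodes D₀ zero) d₀)
  L₁-const : IsConst (source L₁)
  L₁-const = redirect-const zero (constant false)
               (shortcut-killed (nodes D₀ zero) s₀ a (proj₂ (fixed reads-v)) (xor-same a))
  D₁ = eliminate D₀ zero (inj₁ d₀)
  D₁⊨ = eliminate-computes D₀ zero (inj₁ d₀) _ (fix-computes C g v a C⊨g)
  reads-q₁ : ∀ q₁ → ReadsGate C (suc q₁) → ReadsGate D₁ q₁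
  reads-q₁ q₁ (inj₂ out≡q₁) = inj₂ (redirect-other L₁ (cong (fixSource v a) out≡q₁) λ ())
  reads-q₁ q₁ (inj₁ (zero , s , e)) with subst (_≺ zero) e (acyclic C zero s)
  ... | ()
  reads-q₁ q₁ (inj₁ (suc H₂ , s , e)) = inj₁ (H₂ , s , redirect-other L₁ (cong (fixSource v a) e) λ ())
  by-readers : ReadAgain C v → ReadsGate C zero → FewerBy 3 (suc k) (g [ v ≔ a ])
  by-readers (inj₂ out≡v) _ =
    ⊥-elim (const-output⇒constant D₁ D₁⊨ (redirect-const zero L₁ (fixed out≡v)) nonConst)
  by-readers _ (inj₂ out≡0) =
    ⊥-elim (const-output⇒constant D₁ D₁⊨ (redirect-removed zero L₁ (cong (fixSource v a) out≡0) L₁-const) nonConst)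
  by-readers _ (inj₁ (zero , s , e)) = ⊥-elim (≺-irrefl zero _ (acyclic C zero s) e)
  by-readers (inj₁ (q₁ , s₁ , e₁)) (inj₁ (suc H , sH , eH)) with
    eliminate-two D₁ D₁⊨ nonConst q₁ s₁ H sH
      (redirect-const zero L₁ (fixed e₁)) (redirect-removed zero L₁ (cong (fixSource v a) eH) L₁-const)
      (λ { refl refl → input≢node (trans (sym e₁) eH) })
      (reads-q₁ q₁ (clean⇒readsGate C clean (suc q₁)))
  ... | k′ , refl , D′ = k′ , refl , D′

first-gate-reads-input : ∀ (s : Source n (suc k)) → s ≺ zero {n = k} → ¬ IsConst s → ∃[ u ] s ≡ input u
first-gate-reads-input (const v) _  not-const = ⊥-elim (not-const (v , refl))
first-gate-reads-input (input u) _  _         = u , refl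

-- Each recursive call either lowers k, or keeps k and lowers n.
gate-elimination : ∀ {k n} (C : FlatCircuit n k) g t → FlatComputes C g → Hard n g t → 3 * t ≤ k
gate-elimination {n = zero} C g t C⊨g refl = z≤n
gate-elimination C g zero C⊨g hard = z≤n
gate-elimination {zero} {suc n} C g (suc t) C⊨g hard = ⊥-elim (gateless-not-hard C C⊨g hard)
gate-elimination {suc k} {suc n} C g (suc t) C⊨g hard with FinP.any? (eliminable? C)
... | yes (q , e) =
  ≤-trans (gate-elimination (eliminate C q e) g (suc t) (eliminate-computes C q e g C⊨g) hard) (n≤1+n _)
... | no none with input-arg left | input-arg right
  where
  clean : ∀ q → ¬ Eliminable C q
  clean q e = none (q , e)
  input-arg : ∀ s → ∃[ u ] source (arg (nodes C zero) s) ≡ input u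
  input-arg s = first-gate-reads-input _ (acyclic C zero s) (λ c → clean zero (inj₁ (inj₁ (s , c))))
...   | u , reads-u | v , reads-v with hard u | hard v
...     | inj₁ (a , hard′) | _ =
  gate-elimination (fix C u a) (g [ u ≔ a ]) (suc t) (fix-computes C g u a C⊨g) hard′
...     | inj₂ _ | inj₁ (a , hard′) =
  gate-elimination (fix C v a) (g [ v ≔ a ]) (suc t) (fix-computes C g v a C⊨g) hard′
...     | inj₂ (_ , _ , essential-u) | inj₂ (t′ , refl , essential-v) with readAgain? C v
...       | no ¬again =
  ⊥-elim (single-reader C g left C⊨g reads-u u≢v ¬again (proj₂ (proj₂ (essential-u _)) (punchOut u≢v)))
  where
  u≢v : u ≢ v
  u≢v refl = none (zero , inj₁ (inj₂ (trans reads-u (sym reads-v))))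
...       | yes again
  with eliminate-three C g C⊨g (λ q e → none (q , e)) right reads-v again (proj₁ (proj₂ (essential-v _)))
...         | k₃ , refl , D , D⊨ =
  subst (_≤ 3 + k₃) (sym (*-suc 3 t′)) (+-monoʳ-≤ 3 (gate-elimination D _ t′ D⊨ (proj₁ (essential-v _))))

module XorSum = CommutativeMonoidSum (CommutativeRing.+-commutativeMonoid xor-∧-commutativeRing)
module XorAndSum = SemiringSum (CommutativeRing.semiring xor-∧-commutativeRing)
module OrSum = CommutativeMonoidSum ∨-commutativeMonoid

⨁ : (Fin n → Bool) → Bool
⨁ = XorSum.sum

⋁ : (Fin n → Bool) → Bool
⋁ = OrSum.sum

⨁-zero : ∀ (f : Fin n → Bool) → (∀ i → f i ≡ false) → ⨁ f ≡ false
⨁-zero {n} f f≡0 = trans (XorSum.sum-cong-≗ f≡0) (XorSum.sum-replicate-zero n)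

⋁-zero : ∀ (f : Fin n → Bool) → (∀ i → f i ≡ false) → ⋁ f ≡ false
⋁-zero {n} f f≡0 = trans (OrSum.sum-cong-≗ f≡0) (OrSum.sum-replicate-zero n)

⋁-true : ∀ (f : Fin n → Bool) i → f i ≡ true → ⋁ f ≡ true
⋁-true {suc n} f i fi≡true = trans (OrSum.sum-remove {i = i} f) (cong (_∨ ⋁ (f ∘ punchIn i)) fi≡true)

inBlock : Fin B → Fin B → Bool
inBlock b c = does (c Fin.≟ b)

⨁-indicator : ∀ (f : Fin n → Bool) b → ⨁ (λ i → inBlock b i ∧ f i) ≡ f b
⨁-indicator {suc n} f b = begin
  ⨁ (λ i → inBlock b i ∧ f i)                       ≡⟨ XorSum.sum-remove {i = b} (λ i → inBlock b i ∧ f i) ⟩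
  (inBlock b b ∧ f b) xor ⨁ (λ j → inBlock b (punchIn b j) ∧ f (punchIn b j))
    ≡⟨ cong₂ (λ u w → (u ∧ f b) xor w) (dec-true (b Fin.≟ b) refl)
             (⨁-zero _ λ j → cong (_∧ f (punchIn b j)) (dec-false (punchIn b j Fin.≟ b) (FinP.punchInᵢ≢i b j))) ⟩
  f b xor false                                     ≡⟨ xor-identityʳ (f b) ⟩
  f b                                               ∎
  where open ≡-Reasoning

blockParity : (Fin n → Fin B) → Vec Bool n → Fin B → Bool
blockParity lab x b = ⨁ λ i → inBlock b (lab i) ∧ lookup x i

orOfParities : (Fin n → Fin B) → (Fin B → Bool) → Vec Bool n → Bool
orOfParities lab cs x = ⋁ λ b → cs b xor blockParity lab x b

blockParity-fix : ∀ (lab : Fin (suc n) → Fin B) i a x b →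
                  blockParity lab (insertAt x i a) b ≡ (inBlock b (lab i) ∧ a) xor blockParity (lab ∘ punchIn i) x b
blockParity-fix lab i a x b =
  trans (XorSum.sum-remove {i = i} (λ k → inBlock b (lab k) ∧ lookup (insertAt x i a) k))
        (cong₂ (λ u w → (inBlock b (lab i) ∧ u) xor w) (insertAt-lookup x i a)
               (XorSum.sum-cong-≗ λ j → cong (inBlock b (lab (punchIn i j)) ∧_) (insertAt-punchIn x i a j)))

orOfParities-fix : ∀ (lab : Fin (suc n) → Fin B) cs i a →
                   orOfParities lab cs [ i ≔ a ] ≗ orOfParities (lab ∘ punchIn i) (λ b → cs b xor (inBlock b (lab i) ∧ a))
orOfParities-fix lab cs i a x = OrSum.sum-cong-≗ λ b →
  trans (cong (cs b xor_) (blockParity-fix lab i a x b)) (sym (xor-assoc (cs b) _ _))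

orOfParities-drop : ∀ (lab : Fin n → Fin (suc B)) cs b (b≢lab : ∀ j → b ≢ lab j) → cs b ≡ false →
                    orOfParities lab cs ≗ orOfParities (λ j → punchOut (b≢lab j)) (cs ∘ punchIn b)
orOfParities-drop lab cs b b≢lab cs-b x = begin
  orOfParities lab cs x
    ≡⟨ OrSum.sum-remove {i = b} (λ c → cs c xor blockParity lab x c) ⟩
  (cs b xor blockParity lab x b) ∨ ⋁ (λ c → cs (punchIn b c) xor blockParity lab x (punchIn b c))
    ≡⟨ cong₂ (λ u w → (u xor w) ∨ ⋁ (λ c → cs (punchIn b c) xor blockParity lab x (punchIn b c))) cs-b
             (⨁-zero _ λ j → cong (_∧ lookup x j) (dec-false (lab j Fin.≟ b) (b≢lab j ∘ sym))) ⟩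
  ⋁ (λ c → cs (punchIn b c) xor blockParity lab x (punchIn b c))
    ≡⟨ OrSum.sum-cong-≗ (λ c → cong (cs (punchIn b c) xor_)
                                    (XorSum.sum-cong-≗ λ j → cong (_∧ lookup x j) (same-block j c))) ⟩
  orOfParities (λ j → punchOut (b≢lab j)) (cs ∘ punchIn b) x ∎
  where
  open ≡-Reasoning
  same-block : ∀ j c → inBlock (punchIn b c) (lab j) ≡ inBlock c (punchOut (b≢lab j))
  same-block j c with lab j Fin.≟ punchIn b c
  ... | yes e  = sym (dec-true (punchOut (b≢lab j) Fin.≟ c)
                    (trans (FinP.punchOut-cong b e) (FinP.punchOut-punchIn b)))
  ... | no ¬e = sym (dec-false (punchOut (b≢lab j) Fin.≟ c)
                    λ e → ¬e (trans (sym (FinP.punchIn-punchOut (b≢lab j))) (cong (punchIn b) e)))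

blockParity-flip : ∀ (lab : Fin n → Fin B) x j →
                   blockParity lab (updateAt x j not) (lab j) ≡ not (blockParity lab x (lab j))
blockParity-flip {suc n} lab x j = begin
  blockParity lab (updateAt x j not) (lab j)
    ≡⟨ XorSum.sum-remove {i = j} (λ k → inBlock (lab j) (lab k) ∧ lookup (updateAt x j not) k) ⟩
  (inBlock (lab j) (lab j) ∧ lookup (updateAt x j not) j)
    xor ⨁ (λ k → inBlock (lab j) (lab (punchIn j k)) ∧ lookup (updateAt x j not) (punchIn j k))
    ≡⟨ cong₂ (λ u w → (inBlock (lab j) (lab j) ∧ u) xor w) (lookup∘updateAt j x)
             (XorSum.sum-cong-≗ λ k → cong (inBlock (lab j) (lab (punchIn j k)) ∧_)
                                          (lookup∘updateAt′ (punchIn j k) j (FinP.punchInᵢ≢i j k) x)) ⟩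
  (inBlock (lab j) (lab j) ∧ not (lookup x j)) xor rest
    ≡⟨ cong (λ u → (u ∧ not (lookup x j)) xor rest) (dec-true (lab j Fin.≟ lab j) refl) ⟩
  not (lookup x j) xor rest
    ≡⟨ sym (not-distribˡ-xor (lookup x j) rest) ⟩
  not (lookup x j xor rest)
    ≡⟨ cong (λ u → not ((u ∧ lookup x j) xor rest)) (sym (dec-true (lab j Fin.≟ lab j) refl)) ⟩
  not ((inBlock (lab j) (lab j) ∧ lookup x j) xor rest)
    ≡⟨ cong not (sym (XorSum.sum-remove {i = j} (λ k → inBlock (lab j) (lab k) ∧ lookup x k))) ⟩
  not (blockParity lab x (lab j)) ∎
  where
  open ≡-Reasoning
  rest = ⨁ (λ k → inBlock (lab j) (lab (punchIn j k)) ∧ lookup x (punchIn j k))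

module Representatives (lab : Fin n → Fin B) (rep : Fin B → Fin n) (section : ∀ b → lab (rep b) ≡ b) where

  -- Each block's representative is set to its constant, so every block term vanishes.
  balanced : (Fin B → Bool) → Vec Bool n
  balanced cs = tabulate λ k → inBlock (rep (lab k)) k ∧ cs (lab k)

  blockParity-balanced : ∀ cs b → blockParity lab (balanced cs) b ≡ cs b
  blockParity-balanced cs b = trans (XorSum.sum-cong-≗ only-rep) (⨁-indicator (λ _ → cs b) (rep b))
    where
    only-rep : ∀ k → (inBlock b (lab k) ∧ lookup (balanced cs) k) ≡ (inBlock (rep b) k ∧ cs b)
    only-rep k rewrite lookup∘tabulate (λ k → inBlock (rep (lab k)) k ∧ cs (lab k)) k with lab k Fin.≟ b
    ... | yes refl = refl
    ... | no lab≢b = sym (cong (_∧ cs b) (dec-false (k Fin.≟ rep b) λ { refl → lab≢b (section b) }))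

  orOfParities-depends : ∀ cs j → DependsOn (orOfParities lab cs) j
  orOfParities-depends cs j = x₀ , λ e → false≢true (trans (sym before) (trans e after))
    where
    x₀ = balanced cs
    false≢true : false ≢ true
    false≢true ()
    before : orOfParities lab cs x₀ ≡ false
    before = ⋁-zero _ λ b → trans (cong (cs b xor_) (blockParity-balanced cs b)) (xor-same (cs b))
    after : orOfParities lab cs (updateAt x₀ j not) ≡ true
    after = ⋁-true _ (lab j) (trans (cong (cs (lab j) xor_) (trans (blockParity-flip lab x₀ j)
                                                                  (cong not (blockParity-balanced cs (lab j)))))
                                   (xor-inverseʳ (cs (lab j))))

-- When i shares its block with punchIn i j₀, the latter replaces i as representative.
rep-after-fix : ∀ (i : Fin (suc n)) (j₀ : Fin n) (rep : Fin B → Fin (suc n)) → Fin B → Fin n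
rep-after-fix i j₀ rep b with i Fin.≟ rep b
... | yes _   = j₀
... | no i≢r = punchOut i≢r

rep-after-fix-section : ∀ (lab : Fin (suc n) → Fin B) i j₀ rep → lab (punchIn i j₀) ≡ lab i → (∀ b → lab (rep b) ≡ b) →
                        ∀ b → lab (punchIn i (rep-after-fix i j₀ rep b)) ≡ b
rep-after-fix-section lab i j₀ rep shared section b with i Fin.≟ rep b
... | yes refl = trans shared (section b)
... | no i≢r  = trans (cong lab (FinP.punchIn-punchOut i≢r)) (section b)

module WithoutBlock (lab : Fin (suc n) → Fin (suc B)) (rep : Fin (suc B) → Fin (suc n))
                    (section : ∀ b → lab (rep b) ≡ b) (i : Fin (suc n)) (alone : ∀ j → lab i ≢ lab (punchIn i j)) where

  labels : Fin n → Fin B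
  labels j = punchOut (alone j)

  i≢rep : ∀ c → i ≢ rep (punchIn (lab i) c)
  i≢rep c e = FinP.punchInᵢ≢i (lab i) c (trans (sym (section (punchIn (lab i) c))) (cong lab (sym e)))

  reps : Fin B → Fin n
  reps c = punchOut (i≢rep c)

  labels-reps : ∀ c → labels (reps c) ≡ c
  labels-reps c = trans (FinP.punchOut-cong (lab i) (trans (cong lab (FinP.punchIn-punchOut (i≢rep c))) (section _)))
                        (FinP.punchOut-punchIn (lab i))

orOfParities-hard : ∀ n (lab : Fin n → Fin B) cs (rep : Fin B → Fin n) → (∀ b → lab (rep b) ≡ b) →
                    Hard n (orOfParities lab cs) (n ∸ B)
orOfParities-hard {B} zero lab cs rep section = 0∸n≡0 B
orOfParities-hard {B} (suc n) lab cs rep section i with B ≤? n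
... | no B≰n =
  subst (Hard (suc n) (orOfParities lab cs)) (sym (m≤n⇒m∸n≡0 (≰⇒> B≰n))) (hard-zero (suc n) (orOfParities lab cs)) i
... | yes B≤n with FinP.any? (λ j → lab (punchIn i j) Fin.≟ lab i)
...   | yes (j₀ , shared) = inj₂ (n ∸ B , +-∸-assoc 1 B≤n , essential)
  where
  lab′ = lab ∘ punchIn i
  section′ = rep-after-fix-section lab i j₀ rep shared section
  open Representatives lab′ (rep-after-fix i j₀ rep) section′
  essential : ∀ a → Essential n (orOfParities lab cs [ i ≔ a ]) (n ∸ B)
  essential a =
      hard-≗ n back (orOfParities-hard n lab′ cs′ _ section′)
    , nonConstant-≗ back (x₀ , updateAt x₀ j₀ not , differ)
    , λ j → dependsOn-≗ back (orOfParities-depends cs′ j)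
    where
    cs′ = λ b → cs b xor (inBlock b (lab i) ∧ a)
    back = sym ∘ orOfParities-fix lab cs i a
    x₀ = proj₁ (orOfParities-depends cs′ j₀)
    differ = proj₂ (orOfParities-depends cs′ j₀)
orOfParities-hard {zero} (suc n) lab cs rep section i | yes _ | no _ with lab i
... | ()
orOfParities-hard {suc B} (suc n) lab cs rep section i | yes _ | no shares-none =
  inj₁ (cs b , hard-≗ n back (orOfParities-hard n labels (cs′ ∘ punchIn b) reps labels-reps))
  where
  b = lab i
  alone : ∀ j → b ≢ lab (punchIn i j)
  alone j e = shares-none (j , sym e)
  open WithoutBlock lab rep section i alone
  cs′ = λ c → cs c xor (inBlock c b ∧ cs b)
  cs′-b : cs′ b ≡ false
  cs′-b = trans (cong (λ u → cs b xor (u ∧ cs b)) (dec-true (b Fin.≟ b) refl)) (xor-same (cs b))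
  back : orOfParities labels (cs′ ∘ punchIn b) ≗ orOfParities lab cs [ i ≔ cs b ]
  back x = sym (trans (orOfParities-fix lab cs i (cs b) x) (orOfParities-drop (lab ∘ punchIn i) cs′ b alone cs′-b x))

⨁-++ : ∀ m {n} (f : Fin (m + n) → Bool) → ⨁ f ≡ ⨁ (f ∘ (_↑ˡ n)) xor ⨁ (f ∘ (m ↑ʳ_))
⨁-++ zero    f = refl
⨁-++ (suc m) f = trans (cong (f zero xor_) (⨁-++ m (f ∘ suc))) (sym (xor-assoc (f zero) _ _))

⨁-combine : ∀ m {n} (f : Fin (m * n) → Bool) → ⨁ f ≡ ⨁ (λ (i : Fin m) → ⨁ (λ (j : Fin n) → f (combine i j)))
⨁-combine zero        f = refl
⨁-combine (suc m) {n} f =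
  trans (⨁-++ n {m * n} f) (cong (⨁ (λ j → f (j ↑ˡ m * n)) xor_) (⨁-combine m (λ k → f (n ↑ʳ k))))

parity-tabulate : ∀ {m} (f : Fin m → Bool) → parity (tabulate f) ≡ ⨁ f
parity-tabulate {zero}  f = refl
parity-tabulate {suc m} f = cong (f zero xor_) (parity-tabulate (f ∘ suc))

orV-tabulate : ∀ {m} (f : Fin m → Bool) → orV (tabulate f) ≡ ⋁ f
orV-tabulate {zero}  f = refl
orV-tabulate {suc m} f = cong (f zero ∨_) (orV-tabulate (f ∘ suc))

blockParity-quotient : ∀ m (x : Vec Bool (m * m)) b → blockParity (quotient {m} m) x b ≡ ⨁ (λ j → lookup x (combine b j))
blockParity-quotient m x b = begin
  ⨁ (λ k → inBlock b (quotient m k) ∧ lookup x k)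
    ≡⟨ ⨁-combine m (λ k → inBlock b (quotient m k) ∧ lookup x k) ⟩
  ⨁ (λ (i : Fin m) → ⨁ (λ (j : Fin m) → inBlock b (quotient m (combine i j)) ∧ lookup x (combine i j)))
    ≡⟨ XorSum.sum-cong-≗ (λ i → XorSum.sum-cong-≗ λ j → cong (λ c → inBlock b c ∧ lookup x (combine i j))
                                                             (cong proj₁ (FinP.remQuot-combine {m} {m} i j))) ⟩
  ⨁ (λ (i : Fin m) → ⨁ (λ (j : Fin m) → inBlock b i ∧ lookup x (combine i j)))
    ≡⟨ XorSum.sum-cong-≗ (λ i → sym (XorAndSum.*-distribˡ-sum (inBlock b i) (λ (j : Fin m) → lookup x (combine i j)))) ⟩
  ⨁ (λ (i : Fin m) → inBlock b i ∧ ⨁ (λ (j : Fin m) → lookup x (combine i j)))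
    ≡⟨ ⨁-indicator (λ (i : Fin m) → ⨁ (λ (j : Fin m) → lookup x (combine i j))) b ⟩
  ⨁ (λ j → lookup x (combine b j)) ∎
  where open ≡-Reasoning

blockOrParity-sums : ∀ m x → blockOrParity m x ≡ ⋁ (λ (i : Fin m) → ⨁ (λ (j : Fin m) → lookup x (combine i j)))
blockOrParity-sums m x =
  trans (orV-tabulate (λ (i : Fin m) → parity (tabulate λ (j : Fin m) → lookup x (combine i j))))
        (OrSum.sum-cong-≗ {x = λ (i : Fin m) → parity (tabulate λ (j : Fin m) → lookup x (combine i j))}
                      (λ i → parity-tabulate (λ (j : Fin m) → lookup x (combine i j))))

blockOrParity-≗ : ∀ m → blockOrParity m ≗ orOfParities (quotient {m} m) (λ _ → false)
blockOrParity-≗ m x = trans (blockOrParity-sums m x) (OrSum.sum-cong-≗ λ i → sym (blockParity-quotient m x i))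

blockOrParity-hard : ∀ m → Hard (suc m * suc m) (blockOrParity (suc m)) (suc m * suc m ∸ suc m)
blockOrParity-hard m =
  hard-≗ (suc m * suc m) {g = orOfParities (quotient {suc m} (suc m)) (λ _ → false)} {g′ = blockOrParity (suc m)}
         (λ x → sym (blockOrParity-≗ (suc m) x))
  (orOfParities-hard {suc m} (suc m * suc m) (quotient {suc m} (suc m)) (λ _ → false) (λ b → combine b zero) section)
  where
  section : ∀ b → quotient {suc m} (suc m) (combine b zero) ≡ b
  section b = cong proj₁ (FinP.remQuot-combine {suc m} {suc m} b zero)

lookup-∷ʳ-inject₁ : ∀ (v : Vec A w) y j → lookup (v ∷ʳ y) (inject₁ j) ≡ lookup v j
lookup-∷ʳ-inject₁ (x ∷ v) y zero    = refl
lookup-∷ʳ-inject₁ (x ∷ v) y (suc j) = lookup-∷ʳ-inject₁ v y j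

lookup-∷ʳ-last : ∀ (v : Vec A w) y → lookup (v ∷ʳ y) (fromℕ w) ≡ y
lookup-∷ʳ-last []      y = refl
lookup-∷ʳ-last (x ∷ v) y = lookup-∷ʳ-last v y

weakenSource : Source n k → Source n (suc k)
weakenSource (const b) = const b
weakenSource (input i) = input i
weakenSource (node p)  = node (inject₁ p)

weakenNode : Node n k → Node n (suc k)
weakenNode g = mkNode (λ s → weakenSource (source (arg g s)) ⊕ neg (arg g s)) (negOut g)

weaken-≺ : ∀ (s : Source n k) {j : Fin k} → s ≺ j → weakenSource s ≺ inject₁ j
weaken-≺ (const _) _ = tt
weaken-≺ (input _) _ = tt
weaken-≺ (node p) {j} p<j rewrite FinP.toℕ-inject₁ p | FinP.toℕ-inject₁ j = p<j

weaken-≺-last : ∀ (s : Source n k) → weakenSource s ≺ fromℕ k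
weaken-≺-last (const _) = tt
weaken-≺-last (input _) = tt
weaken-≺-last {k = k} (node p) rewrite FinP.toℕ-inject₁ p | FinP.toℕ-fromℕ k = FinP.toℕ<n p

toSource : (gs : Gates n w) → Fin w → Source n (gcount gs)
toSource []       i = input i
toSource (gs ▷ _) i with view i
... | ‵inj₁ {i = j} _ = weakenSource (toSource gs j)
... | ‵fromℕ          = node (fromℕ (gcount gs))

toNode : (gs : Gates n w) → Fin (gcount gs) → Node n (gcount gs)
toNode (gs ▷ gate a b c l r) q with view q
... | ‵inj₁ {i = j} _ = weakenNode (toNode gs j)
... | ‵fromℕ          = mkNode (sides (weakenSource (toSource gs l) ⊕ a) (weakenSource (toSource gs r) ⊕ b)) c

toNode-acyclic : ∀ (gs : Gates n w) q s → source (arg (toNode gs q) s) ≺ q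
toNode-acyclic (gs ▷ gate a b c l r) q s with view q
... | ‵inj₁ {i = j} _ = weaken-≺ _ (toNode-acyclic gs j s)
toNode-acyclic (gs ▷ gate a b c l r) q left  | ‵fromℕ = weaken-≺-last (toSource gs l)
toNode-acyclic (gs ▷ gate a b c l r) q right | ‵fromℕ = weaken-≺-last (toSource gs r)

flatten : (C : Circuit n) → FlatCircuit n (size C)
flatten (circuit gs o) = record { nodes = toNode gs ; acyclic = toNode-acyclic gs ; output = toSource gs o ⊕ false }

gateValue : (gs : Gates n w) → Vec Bool n → Fin (gcount gs) → Bool
gateValue (gs ▷ gate a b c l r) x q with view q
... | ‵inj₁ {i = j} _ = gateValue gs x j
... | ‵fromℕ          = U2 a b c (lookup (evalW gs x) l) (lookup (evalW gs x) r)

readSource-weaken : ∀ (gs : Gates n w) g x s →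
                    readSource x (gateValue (gs ▷ g) x) (weakenSource s) ≡ readSource x (gateValue gs x) s
readSource-weaken gs g x (const _) = refl
readSource-weaken gs g x (input _) = refl
readSource-weaken gs (gate a b c l r) x (node p) rewrite view-inject₁ p = refl

readSource-toSource : ∀ (gs : Gates n w) x i → readSource x (gateValue gs x) (toSource gs i) ≡ lookup (evalW gs x) i
readSource-toSource []       x i = refl
readSource-toSource (gs ▷ g@(gate a b c l r)) x i with view i
... | ‵inj₁ {i = j} _ = trans (readSource-weaken gs g x (toSource gs j))
                              (trans (readSource-toSource gs x j) (sym (lookup-∷ʳ-inject₁ (evalW gs x) _ j)))
... | ‵fromℕ rewrite view-fromℕ (gcount gs) = sym (lookup-∷ʳ-last (evalW gs x) _)

gateValue-consistent : ∀ (gs : Gates n w) x q → gateValue gs x q ≡ evalNode x (gateValue gs x) (toNode gs q)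
gateValue-consistent (gs ▷ g@(gate a b c l r)) x q with view q
... | ‵inj₁ {i = j} _ = trans (gateValue-consistent gs x j)
  (sym (evalNode-by-args (weakenNode (toNode gs j)) (toNode gs j) refl λ s →
          cong (_xor neg (arg (toNode gs j) s)) (readSource-weaken gs g x (source (arg (toNode gs j) s)))))
... | ‵fromℕ = sym (cong₂ (U2 a b c) (trans (readSource-weaken gs g x (toSource gs l)) (readSource-toSource gs x l))
                                    (trans (readSource-weaken gs g x (toSource gs r)) (readSource-toSource gs x r)))

flatten-computes : ∀ (C : Circuit n) f → Computes C f → FlatComputes (flatten C) f
flatten-computes C@(circuit gs o) f C⊨f x = begin
  readSource x (value (flatten C) x) (toSource gs o) xor false
    ≡⟨ xor-identityʳ _ ⟩
  readSource x (value (flatten C) x) (toSource gs o)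
    ≡⟨ readSource-cong x (toSource gs o) (consistent⇒value (flatten C) x (gateValue-consistent gs x)) ⟩
  readSource x (gateValue gs x) (toSource gs o)
    ≡⟨ readSource-toSource gs x o ⟩
  lookup (evalW gs x) o
    ≡⟨ C⊨f x ⟩
  f x ∎
  where open ≡-Reasoning

wire : Gates n w → Vec Bool n → Fin w → Bool
wire gs x i = lookup (evalW gs x) i

data Extension {n w} (gs : Gates n w) : Gates n w′ → ℕ → Set where
  stop : Extension gs gs 0
  more : ∀ {gs′ : Gates n w′} {g} → Extension gs gs′ d → Extension gs (gs′ ▷ g) (suc d)

embed : {gs : Gates n w} {gs′ : Gates n w′} → Extension gs gs′ d → Fin w → Fin w′
embed stop     i = i
embed (more e) i = inject₁ (embed e i)

wire-embed : ∀ {gs : Gates n w} {gs′ : Gates n w′} (e : Extension gs gs′ d) x i → wire gs′ x (embed e i) ≡ wire gs x i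
wire-embed stop x i = refl
wire-embed (more {gs′ = gs′} {gate a b c l r} e) x i =
  trans (lookup-∷ʳ-inject₁ (evalW gs′ x) _ (embed e i)) (wire-embed e x i)

_⨾_ : {gs : Gates n w} {gs′ : Gates n w′} {gs″ : Gates n w″} →
      Extension gs gs′ d → Extension gs′ gs″ d′ → Extension gs gs″ (d′ + d)
e ⨾ stop     = e
e ⨾ more e′ = more (e ⨾ e′)

gcount-extension : {gs : Gates n w} {gs′ : Gates n w′} → Extension gs gs′ d → gcount gs′ ≡ d + gcount gs
gcount-extension stop     = refl
gcount-extension (more e) = cong suc (gcount-extension e)

record Builds (gs : Gates n w) (d : ℕ) (P : Vec Bool n → Bool) : Set where
  constructor builds
  field
    {width}   : ℕ
    body      : Gates n width
    extension : Extension gs body d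
    out       : Fin width
    computes  : ∀ x → wire body x out ≡ P x

append : ∀ (gs : Gates n w) a b c l r → Builds gs 1 (λ x → U2 a b c (wire gs x l) (wire gs x r))
append {w = w} gs a b c l r = builds _ (more stop) (fromℕ w) (λ x → lookup-∷ʳ-last (evalW gs x) _)

U2-and : ∀ u v → U2 false false false u v ≡ u ∧ v
U2-and false false = refl
U2-and false true  = refl
U2-and true  false = refl
U2-and true  true  = refl

U2-or : ∀ u v → U2 true true true u v ≡ u ∨ v
U2-or false false = refl
U2-or false true  = refl
U2-or true  false = refl
U2-or true  true  = refl

U2-and-not : ∀ u v → U2 false true false u v ≡ u ∧ not v
U2-and-not false false = refl
U2-and-not false true  = refl
U2-and-not true  false = refl
U2-and-not true  true  = refl

-- x ⊕ y = (x ∨ y) ∧ ¬(x ∧ y) with three gates.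
xorBuilds : ∀ (gs : Gates n w) p q → Builds gs 3 (λ x → wire gs x p xor wire gs x q)
xorBuilds {w = w} gs p q = builds gs₃ (more (more (more stop))) (fromℕ (suc (suc w))) correct
  where
  gs₁ = gs ▷ gate false false false p q
  gs₂ = gs₁ ▷ gate true true true (inject₁ p) (inject₁ q)
  gs₃ = gs₂ ▷ gate false true false (fromℕ (suc w)) (inject₁ (fromℕ w))
  correct : ∀ x → wire gs₃ x (fromℕ (suc (suc w))) ≡ (wire gs x p xor wire gs x q)
  correct x = begin
    wire gs₃ x (fromℕ (suc (suc w)))
      ≡⟨ lookup-∷ʳ-last (evalW gs₂ x) _ ⟩
    U2 false true false (wire gs₂ x (fromℕ (suc w))) (wire gs₂ x (inject₁ (fromℕ w)))
      ≡⟨ cong₂ (U2 false true false) or-wire and-wire ⟩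
    U2 false true false (wire gs x p ∨ wire gs x q) (wire gs x p ∧ wire gs x q)
      ≡⟨ U2-and-not (wire gs x p ∨ wire gs x q) (wire gs x p ∧ wire gs x q) ⟩
    (wire gs x p ∨ wire gs x q) ∧ not (wire gs x p ∧ wire gs x q)
      ≡⟨ sym (xor-is-ok (wire gs x p) (wire gs x q)) ⟩
    wire gs x p xor wire gs x q ∎
    where
    open ≡-Reasoning
    old : ∀ i → wire gs₁ x (inject₁ i) ≡ wire gs x i
    old i = lookup-∷ʳ-inject₁ (evalW gs x) _ i
    or-wire : wire gs₂ x (fromℕ (suc w)) ≡ wire gs x p ∨ wire gs x q
    or-wire = trans (lookup-∷ʳ-last (evalW gs₁ x) _)
                    (trans (cong₂ (U2 true true true) (old p) (old q)) (U2-or (wire gs x p) (wire gs x q)))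
    and-wire : wire gs₂ x (inject₁ (fromℕ w)) ≡ wire gs x p ∧ wire gs x q
    and-wire = trans (lookup-∷ʳ-inject₁ (evalW gs₁ x) _ (fromℕ w))
                     (trans (lookup-∷ʳ-last (evalW gs x) _) (U2-and (wire gs x p) (wire gs x q)))

inputWire : Gates n w → Fin n → Fin w
inputWire []       i = i
inputWire (gs ▷ _) i = inject₁ (inputWire gs i)

wire-input : ∀ (gs : Gates n w) x i → wire gs x (inputWire gs i) ≡ lookup x i
wire-input []                       x i = refl
wire-input (gs ▷ gate a b c l r) x i = trans (lookup-∷ʳ-inject₁ (evalW gs x) _ (inputWire gs i)) (wire-input gs x i)

parityBuilds : ∀ (gs : Gates n w) z → (∀ x → wire gs x z ≡ false) → ∀ {m} (f : Fin m → Fin n) →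
               Builds gs (3 * m) (λ x → ⨁ (λ j → lookup x (f j)))
parityBuilds gs z z-false {zero} f = builds gs stop z z-false
parityBuilds gs z z-false {suc m} f with parityBuilds gs z z-false (λ j → f (suc j))
... | builds gs₁ e₁ o₁ ok₁ with xorBuilds gs₁ (inputWire gs₁ (f zero)) o₁
...   | builds gs₂ e₂ o₂ ok₂ = subst (λ d → Builds gs d (λ x → ⨁ (λ j → lookup x (f j)))) (sym (*-suc 3 m))
  (builds gs₂ (e₁ ⨾ e₂) o₂ λ x → trans (ok₂ x) (cong₂ _xor_ (wire-input gs₁ x (f zero)) (ok₁ x)))

blocksBuild : ∀ (gs : Gates n w) z → (∀ x → wire gs x z ≡ false) → ∀ {B M} (h : Fin B → Fin M → Fin n) →
              Builds gs (B * suc (3 * M)) (λ x → ⋁ (λ i → ⨁ (λ j → lookup x (h i j))))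
blocksBuild gs z z-false {zero} h = builds gs stop z z-false
blocksBuild gs z z-false {suc B} h with blocksBuild gs z z-false (λ i → h (suc i))
... | builds gs₁ e₁ o₁ ok₁ with parityBuilds gs₁ (embed e₁ z) (λ x → trans (wire-embed e₁ x z) (z-false x)) (h zero)
...   | builds gs₂ e₂ o₂ ok₂ with append gs₂ true true true o₂ (embed e₂ o₁)
...     | builds gs₃ e₃ o₃ ok₃ = builds gs₃ ((e₁ ⨾ e₂) ⨾ e₃) o₃ λ x →
  trans (ok₃ x) (trans (U2-or (wire gs₂ x o₂) (wire gs₂ x (embed e₂ o₁)))
                       (cong₂ _∨_ (ok₂ x) (trans (wire-embed e₂ x o₁) (ok₁ x))))

falseWire : Gates (suc n) (suc (suc n))
falseWire = [] ▷ gate false true false zero zero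

falseWire-false : ∀ (x : Vec Bool (suc n)) → wire falseWire x (fromℕ (suc n)) ≡ false
falseWire-false x = trans (lookup-∷ʳ-last x _) (trans (U2-and-not (lookup x zero) (lookup x zero)) (∧-inverseʳ (lookup x zero)))

blockOrParity-circuit : ∀ m → ∃[ C ] Computes C (blockOrParity (suc m)) × size C ≡ suc m * suc (3 * suc m) + 1
blockOrParity-circuit m =
  circuit body out , (λ x → trans (computes x) (sym (blockOrParity-sums (suc m) x))) , gcount-extension extension
  where open Builds (blocksBuild falseWire (fromℕ _) falseWire-false {suc m} {suc m} combine)

upper-arith : ∀ k M → k < M → k * (M * suc (3 * M) + 1) ≤ (3 * k + 1) * (M * M)
upper-arith k M k<M = begin
  k * (M * suc (3 * M) + 1)   ≡⟨ expand k M ⟩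
  3 * k * (M * M) + (k * M + k) ≤⟨ +-monoʳ-≤ (3 * k * (M * M)) small ⟩
  3 * k * (M * M) + M * M       ≡⟨ collect k M ⟩
  (3 * k + 1) * (M * M) ∎
  where
  open ≤-Reasoning
  expand : ∀ k M → k * (M * suc (3 * M) + 1) ≡ 3 * k * (M * M) + (k * M + k)
  expand = solve-∀
  collect : ∀ k M → 3 * k * (M * M) + M * M ≡ (3 * k + 1) * (M * M)
  collect = solve-∀
  small : k * M + k ≤ M * M
  small = begin
    k * M + k ≤⟨ +-monoʳ-≤ (k * M) (<⇒≤ k<M) ⟩
    k * M + M ≡⟨ +-comm (k * M) M ⟩
    suc k * M ≤⟨ *-monoˡ-≤ M k<M ⟩
    M * M     ∎

lower-arith : ∀ k M s → 3 * k ≤ M → 3 * (M * M ∸ M) ≤ s → (3 * k ∸ 1) * (M * M) ≤ k * s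
lower-arith k M s 3k≤M eliminated = begin
  (3 * k ∸ 1) * (M * M)           ≡⟨ *-distribʳ-∸ (M * M) (3 * k) 1 ⟩
  3 * k * (M * M) ∸ 1 * (M * M)   ≡⟨ cong (3 * k * (M * M) ∸_) (*-identityˡ (M * M)) ⟩
  3 * k * (M * M) ∸ M * M         ≤⟨ ∸-monoʳ-≤ (3 * k * (M * M)) (*-monoˡ-≤ M 3k≤M) ⟩
  3 * k * (M * M) ∸ 3 * k * M     ≡⟨ sym (*-distribˡ-∸ (3 * k) (M * M) M) ⟩
  3 * k * (M * M ∸ M)             ≡⟨ regroup k (M * M ∸ M) ⟩
  k * (3 * (M * M ∸ M))           ≤⟨ *-monoʳ-≤ k eliminated ⟩
  k * s                           ∎
  where
  open ≤-Reasoning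
  regroup : ∀ k X → 3 * k * X ≡ k * (3 * X)
  regroup = solve-∀

lemma3 : ∀ (k : ℕ) → 1 ≤ k → ∃[ N ] ∀ (m : ℕ) → N ≤ m →
           (∃[ C ] (Computes {m * m} C (blockOrParity m) × k * size C ≤ (3 * k + 1) * (m * m)))
           × (∀ (C : Circuit (m * m)) → Computes C (blockOrParity m) → (3 * k ∸ 1) * (m * m) ≤ k * size C)
lemma3 zero ()
lemma3 k@(suc k′) _ = 3 * k , bounds
  where
  bounds : ∀ m → 3 * k ≤ m →
           (∃[ C ] (Computes {m * m} C (blockOrParity m) × k * size C ≤ (3 * k + 1) * (m * m)))
           × (∀ (C : Circuit (m * m)) → Computes C (blockOrParity m) → (3 * k ∸ 1) * (m * m) ≤ k * size C)
  bounds (suc m) 3k≤m =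
    (C , C⊨ , subst (λ s → k * s ≤ (3 * k + 1) * (suc m * suc m)) (sym size-C) (upper-arith k (suc m) k<m)) , lower-bound
    where
    C = proj₁ (blockOrParity-circuit m)
    C⊨ = proj₁ (proj₂ (blockOrParity-circuit m))
    size-C = proj₂ (proj₂ (blockOrParity-circuit m))
    k<m : k < suc m
    k<m = <-≤-trans (m<m+n k (s≤s z≤n)) 3k≤m
    lower-bound : ∀ (D : Circuit (suc m * suc m)) → Computes D (blockOrParity (suc m)) →
                  (3 * k ∸ 1) * (suc m * suc m) ≤ k * size D
    lower-bound D D⊨ = lower-arith k (suc m) (size D) 3k≤m
      (gate-elimination (flatten D) _ _ (flatten-computes D _ D⊨) (blockOrParity-hard m))
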